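{- For $n\ge1$ and $k\ge1$, the number of weakly increasing Fubini rankings with $n$ competitors having exactly $k$ lucky cars is $f^{\uparrow}_{\mathrm{FR}}(n,k)=\binom{n-1}{k-1}$, and the total number of weakly increasing Fubini rankings with $n$ competitors is $|\mathrm{FR}_n^{\uparrow}|=2^{n-1}$.
   Context: A Fubini ranking with $n$ competitors is a tuple $\alpha=(a_1,\ldots,a_n)\in\{1,\ldots,n\}^n$ with $a_i=1+|\{j:a_j<a_i\}|$ for every $i$; it is weakly increasing if $a_1\le a_2\le\cdots\le a_n$, and $\mathrm{FR}_n^{\uparrow}$ denotes the set of these. Lucky cars: cars $1,\ldots,n$ enter in order a one-way street with spots $1,\ldots,n$; car $i$ parks at spot $a_i$ if free, else at the first free spot after $a_i$; car $i$ is lucky if it parks at spot $a_i$. -}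

module Defs where

open import Data.Nat using (ℕ; zero; suc; _+_; _∸_; _<ᵇ_; _≡ᵇ_)
open import Data.Bool using (Bool; true; false; _∧_; not; if_then_else_)
open import Data.List using (List; []; _∷_; _++_; map; concatMap; filter; length; upTo)
open import Data.Bool.ListAction using (all; any)
open import Data.Vec using (Vec; []; _∷_; toList)
open import Data.Maybe using (Maybe; just; nothing)
open import Relation.Nullary.Decidable using (does)
open import Relation.Unary using (Decidable)
open import Relation.Binary.PropositionalEquality using (_≡_)
open import Data.Bool.Properties using (_≟_)

tuples : (m k : ℕ) → List (Vec ℕ k)
tuples m zero = [] ∷ []
tuples m (suc k) = concatMap (λ v → map (λ x → suc x ∷ v) (upTo m)) (tuples m k)

countBelow : ℕ → List ℕ → ℕ
countBelow x l = length (filter (λ y → y Data.Nat.<? x) l)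

isFubiniᵇ : {n : ℕ} → Vec ℕ n → Bool
isFubiniᵇ a = all (λ x → x ≡ᵇ suc (countBelow x (toList a))) (toList a)

weaklyIncᵇ : List ℕ → Bool
weaklyIncᵇ [] = true
weaklyIncᵇ (x ∷ []) = true
weaklyIncᵇ (x ∷ y ∷ l) = (x Data.Nat.≤ᵇ y) ∧ weaklyIncᵇ (y ∷ l)

occupied : ℕ → List ℕ → Bool
occupied s occ = any (λ t → t ≡ᵇ s) occ

firstFree : (fuel s : ℕ) → List ℕ → Maybe ℕ
firstFree zero s occ = nothing
firstFree (suc f) s occ = if occupied s occ then firstFree f (suc s) occ else just s

-- spot where a car with preference a parks on a street with spots 1..n (nothing = leaves)
parkSpot : (n a : ℕ) → List ℕ → Maybe ℕ
parkSpot n a occ = firstFree (suc n ∸ a) a occ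

luckyRun : (n : ℕ) → List ℕ → List ℕ → ℕ
luckyRun n occ [] = 0
luckyRun n occ (a ∷ as) with parkSpot n a occ
... | nothing = luckyRun n occ as
... | just s = (if s ≡ᵇ a then 1 else 0) + luckyRun n (s ∷ occ) as

luckyCount : {n : ℕ} → Vec ℕ n → ℕ
luckyCount {n} a = luckyRun n [] (toList a)

isWIFubiniᵇ : {n : ℕ} → Vec ℕ n → Bool
isWIFubiniᵇ a = isFubiniᵇ a ∧ weaklyIncᵇ (toList a)

FRup : (n : ℕ) → List (Vec ℕ n)
FRup n = filter (λ a → isWIFubiniᵇ a ≟ true) (tuples n n)

fFRup : (n k : ℕ) → ℕ
fFRup n k = length (filter (λ a → luckyCount a Data.Nat.≟ k) (FRup n))

{-# OPTIONS --safe #-}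

-- In a weakly increasing list the number of entries below a value is the position of
-- its first occurrence, so a₁ ≤ ⋯ ≤ aₙ is a Fubini ranking iff a₁ = 1 and each aᵢ₊₁
-- either ties with aᵢ or is a new rank i+1: there are 2ⁿ⁻¹ such rankings, one for each
-- choice of tie/new for competitors 2, …, n. Since aᵢ ≤ i, car i arrives when spots
-- 1, …, i-1 are taken, parks at spot i, and is lucky iff aᵢ = i, i.e. iff it opens a new
-- rank. Car 1 is always lucky, so k lucky cars means k-1 "new" among n-1 choices.

module Submission where

open import Defs
open import Data.Bool using (true; false; T; _∨_; if_then_else_)
open import Data.Bool.Properties as Bool using (T-≡; T-∧; ∨-zeroʳ)
open import Data.Nat using (ℕ; zero; suc; _+_; _∸_; _^_; _≤_; _<_; z≤n; s≤s; _≡ᵇ_; _<?_)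
open import Data.Nat.Properties
open import Data.Nat.Combinatorics using (_C_; nCk+nC[k+1]≡[n+1]C[k+1])
open import Data.List using (List; []; _∷_; [_]; _++_; _ʳ++_; map; filter; length; upTo; concatMap; cartesianProductWith)
open import Data.List.Properties using (length-++; length-map; filter-++; filter-accept; filter-none; filter-≐; filter-notAll)
open import Data.List.Relation.Unary.All as All using (All; []; _∷_)
open import Data.List.Relation.Unary.All.Properties using (all⁺; all⁻)
import Data.List.Relation.Unary.Any as Any
open import Data.List.Relation.Unary.AllPairs using ([]; _∷_)
open import Data.List.Relation.Unary.Linked as Linked using (Linked; []; [-]; _∷_)
open import Data.List.Relation.Unary.Linked.Properties using (Linked⇒All)
open import Data.List.Relation.Unary.Unique.Propositional using (Unique)
import Data.List.Relation.Unary.Unique.Propositional.Properties as Unique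
open import Data.List.Membership.Propositional using (_∈_)
open import Data.List.Membership.Propositional.Properties
  using (∈-filter⁺; ∈-filter⁻; ∈-map⁺; ∈-map⁻; ∈-++⁺ˡ; ∈-++⁺ʳ; ∈-++⁻; ∈-upTo⁺; ∈-cartesianProductWith⁺)
open import Data.List.Membership.Propositional.Properties.WithK using (unique∧set⇒bag)
open import Data.List.Relation.Binary.BagAndSetEquality using (∼bag⇒↭)
open import Data.List.Relation.Binary.Permutation.Propositional using (_↭_)
open import Data.List.Relation.Binary.Permutation.Propositional.Properties using (↭-length; filter-↭)
open import Data.Vec using (Vec; toList) renaming ([] to []ᵛ; _∷_ to _∷ᵛ_)
open import Data.Vec.Properties using (length-toList; ∷-injectiveˡ; ∷-injectiveʳ)
open import Data.Maybe using (just)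
open import Data.Unit using (tt)
open import Data.Product using (_×_; _,_; proj₂)
open import Data.Product.Function.NonDependent.Propositional using (_×-⇔_)
open import Data.Sum using (inj₁; inj₂)
open import Function using (_∘_; case_of_; _⇔_; mk⇔; Equivalence)
import Function.Properties.Equivalence as ⇔
open import Relation.Nullary using (yes; no; does; contradiction)
open import Relation.Unary using (Decidable)
open import Relation.Nullary.Decidable using (dec-true; dec-false)
open import Relation.Binary.PropositionalEquality hiding ([_])

open Equivalence using (to; from)

count : {A : Set} → (A → ℕ) → ℕ → List A → ℕ
count f k xs = length (filter (λ x → f x ≟ k) xs)

module _ {A : Set} (f : A → ℕ) (k : ℕ) where

  count-++ : ∀ xs ys → count f k (xs ++ ys) ≡ count f k xs + count f k ys
  count-++ xs ys = trans (cong length (filter-++ _ xs ys)) (length-++ (filter _ xs))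

  count-↭ : ∀ {xs ys} → xs ↭ ys → count f k xs ≡ count f k ys
  count-↭ xs↭ys = ↭-length (filter-↭ _ xs↭ys)

  count-suc : ∀ xs → count (suc ∘ f) (suc k) xs ≡ count f k xs
  count-suc xs = cong length (filter-≐ _ _ (suc-injective , cong suc) xs)

count-suc-zero : {A : Set} (f : A → ℕ) (xs : List A) → count (suc ∘ f) zero xs ≡ 0
count-suc-zero f xs = cong length (filter-none (λ x → suc (f x) ≟ zero) {xs} (All.tabulate λ _ ()))

filter-map : {A B : Set} {P : B → Set} (P? : Decidable P) (g : A → B) (xs : List A) →
  filter P? (map g xs) ≡ map g (filter (P? ∘ g) xs)
filter-map P? g [] = refl
filter-map P? g (x ∷ xs) with does (P? (g x))
... | true  = cong (g x ∷_) (filter-map P? g xs)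
... | false = filter-map P? g xs

count-map : {A B : Set} {f : B → ℕ} {g : A → B} {h : A → ℕ} →
  (∀ x → f (g x) ≡ h x) → ∀ k xs → count f k (map g xs) ≡ count h k xs
count-map {f = f} {g} {h} fg≗h k xs = begin
  length (filter (λ y → f y ≟ k) (map g xs))           ≡⟨ cong length (filter-map _ g xs) ⟩
  length (map g (filter (λ x → f (g x) ≟ k) xs))       ≡⟨ length-map g (filter _ xs) ⟩
  length (filter (λ x → f (g x) ≟ k) xs)               ≡⟨ cong length (filter-≐ _ _ same xs) ⟩
  length (filter (λ x → h x ≟ k) xs)                   ∎
  where
  open ≡-Reasoning
  same = (λ {x} → trans (sym (fg≗h x))) , (λ {x} → trans (fg≗h x))

concatMap-map≡cartesianProductWith : {A B C : Set} (f : A → B → C) (xs : List A) (ys : List B) →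
  concatMap (λ x → map (f x) ys) xs ≡ cartesianProductWith f xs ys
concatMap-map≡cartesianProductWith f [] ys = refl
concatMap-map≡cartesianProductWith f (x ∷ xs) ys =
  cong (map (f x) ys ++_) (concatMap-map≡cartesianProductWith f xs ys)

tuples-suc : ∀ m k → tuples m (suc k) ≡ cartesianProductWith (λ v x → suc x ∷ᵛ v) (tuples m k) (upTo m)
tuples-suc m k = concatMap-map≡cartesianProductWith (λ v x → suc x ∷ᵛ v) (tuples m k) (upTo m)

tuples-unique : ∀ m k → Unique (tuples m k)
tuples-unique m zero = [] ∷ []
tuples-unique m (suc k) rewrite tuples-suc m k =
  Unique.cartesianProductWith⁺ _ (λ { refl → refl , refl }) (tuples-unique m k) (Unique.upTo⁺ m)

∈-tuples⁺ : ∀ {m k} (a : Vec ℕ k) → All (λ x → 1 ≤ x × x ≤ m) (toList a) → a ∈ tuples m k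
∈-tuples⁺ []ᵛ [] = Any.here refl
∈-tuples⁺ {m} {suc k} (suc x ∷ᵛ a) ((_ , x<m) ∷ bounds) rewrite tuples-suc m k =
  ∈-cartesianProductWith⁺ (λ v x → suc x ∷ᵛ v) (∈-tuples⁺ a bounds) (∈-upTo⁺ x<m)

Ranked : List ℕ → ℕ → Set
Ranked l x = x ≡ suc (countBelow x l)

Fubini : List ℕ → Set
Fubini l = All (Ranked l) l

T-isFubiniᵇ : ∀ {n} (a : Vec ℕ n) → T (isFubiniᵇ a) ⇔ Fubini (toList a)
T-isFubiniᵇ a = mk⇔ (All.map (≡ᵇ⇒≡ _ _) ∘ all⁺ _ (toList a)) (all⁻ _ ∘ All.map (≡⇒≡ᵇ _ _))

weaklyIncᵇ⇒sorted : ∀ l → T (weaklyIncᵇ l) → Linked _≤_ l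
weaklyIncᵇ⇒sorted []          _ = []
weaklyIncᵇ⇒sorted (x ∷ [])    _ = [-]
weaklyIncᵇ⇒sorted (x ∷ y ∷ l) t =
  let x≤ᵇy , w = to T-∧ t in ≤ᵇ⇒≤ x y x≤ᵇy ∷ weaklyIncᵇ⇒sorted (y ∷ l) w

sorted⇒weaklyIncᵇ : ∀ {l} → Linked _≤_ l → T (weaklyIncᵇ l)
sorted⇒weaklyIncᵇ []             = tt
sorted⇒weaklyIncᵇ [-]            = tt
sorted⇒weaklyIncᵇ (x≤y ∷ sorted) = from T-∧ (≤⇒≤ᵇ x≤y , sorted⇒weaklyIncᵇ sorted)

WIFubini : List ℕ → Set
WIFubini l = Fubini l × Linked _≤_ l

T-isWIFubiniᵇ : ∀ {n} (a : Vec ℕ n) → T (isWIFubiniᵇ a) ⇔ WIFubini (toList a)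
T-isWIFubiniᵇ a =
  ⇔.trans T-∧ (T-isFubiniᵇ a ×-⇔ mk⇔ (weaklyIncᵇ⇒sorted (toList a)) sorted⇒weaklyIncᵇ)

Fubini⇒bounded : ∀ {l} → Fubini l → All (λ x → 1 ≤ x × x ≤ length l) l
Fubini⇒bounded {l} fubini = All.tabulate λ x∈l → bounded x∈l (All.lookup fubini x∈l)
  where
  bounded : ∀ {x} → x ∈ l → Ranked l x → 1 ≤ x × x ≤ length l
  bounded {x} x∈l x≡ = subst (λ y → 1 ≤ y × y ≤ length l) (sym x≡)
    (s≤s z≤n , filter-notAll (_<? x) l (Any.map (λ { refl → n≮n x }) x∈l))

∈-FRup : ∀ {n} {a : Vec ℕ n} → a ∈ FRup n ⇔ WIFubini (toList a)
∈-FRup {n} {a} = mk⇔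
  (λ a∈ → to (T-isWIFubiniᵇ a) (from T-≡ (proj₂ (∈-filter⁻ wiFubini? {xs = tuples n n} a∈))))
  (λ wf → ∈-filter⁺ wiFubini? (∈-tuples⁺ a (bounds wf)) (to T-≡ (from (T-isWIFubiniᵇ a) wf)))
  where
  wiFubini? = λ (a : Vec ℕ n) → isWIFubiniᵇ a Bool.≟ true
  bounds : WIFubini (toList a) → All (λ x → 1 ≤ x × x ≤ n) (toList a)
  bounds (fubini , _) =
    subst (λ m → All (λ x → 1 ≤ x × x ≤ m) (toList a)) (length-toList a) (Fubini⇒bounded fubini)

FRup-unique : ∀ n → Unique (FRup n)
FRup-unique n = Unique.filter⁺ _ (tuples-unique n n)

-- A list is traversed as pre ʳ++ s with the visited prefix pre kept reversed, so that
-- moving the head of s onto pre leaves pre ʳ++ s unchanged definitionally.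

countBelow-ʳ++ : ∀ {x} pre s → All (_< x) pre → countBelow x (pre ʳ++ s) ≡ length pre + countBelow x s
countBelow-ʳ++ [] s [] = refl
countBelow-ʳ++ {x} (p ∷ pre) s (p<x ∷ pre<x) = begin
  countBelow x (pre ʳ++ (p ∷ s))     ≡⟨ countBelow-ʳ++ pre (p ∷ s) pre<x ⟩
  length pre + countBelow x (p ∷ s)  ≡⟨ cong (λ c → length pre + length c) (filter-accept (_<? x) p<x) ⟩
  length pre + suc (countBelow x s)  ≡⟨ +-suc (length pre) _ ⟩
  suc (length pre) + countBelow x s  ∎
  where open ≡-Reasoning

countBelow-≥ : ∀ {x} s → All (x ≤_) s → countBelow x s ≡ 0
countBelow-≥ s x≤s = cong length (filter-none _ (All.map ≤⇒≯ x≤s))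

countBelow-ʳ++-≥ : ∀ {x} pre s → All (_< x) pre → All (x ≤_) s →
  countBelow x (pre ʳ++ s) ≡ length pre
countBelow-ʳ++-≥ pre s pre<x x≤s =
  trans (countBelow-ʳ++ pre s pre<x) (trans (cong (length pre +_) (countBelow-≥ s x≤s)) (+-identityʳ _))

Ranked⇔suc-length : ∀ {x} pre r → All (_< x) pre → Linked _≤_ (x ∷ r) →
  Ranked (pre ʳ++ (x ∷ r)) x ⇔ (x ≡ suc (length pre))
Ranked⇔suc-length pre r pre<x sorted =
  mk⇔ (λ x-ranked → trans x-ranked (cong suc below)) (λ x≡ → trans x≡ (cong suc (sym below)))
  where below = countBelow-ʳ++-≥ pre _ pre<x (Linked⇒All ≤-trans ≤-refl sorted)

-- Continues v q s: s extends a weakly increasing Fubini ranking that has q entries, the last being v.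
data Continues : ℕ → ℕ → List ℕ → Set where
  []  : ∀ {v q} → Continues v q []
  tie : ∀ {v q s} → Continues v (suc q) s → Continues v q (v ∷ s)
  new : ∀ {v q s} → Continues (suc q) (suc q) s → Continues v q (suc q ∷ s)

Continues⇒sorted : ∀ {v q s} → v ≤ q → Continues v q s → Linked _≤_ (v ∷ s)
Continues⇒sorted v≤q []      = [-]
Continues⇒sorted v≤q (tie c) = ≤-refl ∷ Continues⇒sorted (m≤n⇒m≤1+n v≤q) c
Continues⇒sorted v≤q (new c) = m≤n⇒m≤1+n v≤q ∷ Continues⇒sorted ≤-refl c

ranked⇒Continues : ∀ {v} pre s → All (_≤ v) pre → Linked _≤_ (v ∷ s) →
  All (Ranked (pre ʳ++ s)) s → Continues v (length pre) s
ranked⇒Continues pre [] _ _ [] = []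
ranked⇒Continues {v} pre (x ∷ r) pre≤v (v≤x ∷ sorted) (x-ranked ∷ r-ranked) with x ≟ v
... | yes refl = tie (ranked⇒Continues (x ∷ pre) r (≤-refl ∷ pre≤v) sorted r-ranked)
... | no x≢v
  with pre<x ← All.map (λ p≤v → ≤-<-trans p≤v (≤∧≢⇒< v≤x (x≢v ∘ sym))) pre≤v
  with refl ← to (Ranked⇔suc-length pre r pre<x sorted) x-ranked =
  new (ranked⇒Continues (x ∷ pre) r (≤-refl ∷ All.map <⇒≤ pre<x) sorted r-ranked)

Continues⇒ranked : ∀ {v} pre s → All (_≤ v) pre → v ≤ length pre → Ranked (pre ʳ++ s) v →
  Continues v (length pre) s → All (Ranked (pre ʳ++ s)) s
Continues⇒ranked pre [] _ _ _ [] = []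
Continues⇒ranked pre (v ∷ r) pre≤v v≤q v-ranked (tie c) =
  v-ranked ∷ Continues⇒ranked (v ∷ pre) r (≤-refl ∷ pre≤v) (m≤n⇒m≤1+n v≤q) v-ranked c
Continues⇒ranked pre (x ∷ r) pre≤v v≤q v-ranked (new c) =
  x-ranked ∷ Continues⇒ranked (x ∷ pre) r (≤-refl ∷ All.map <⇒≤ pre<x) ≤-refl x-ranked c
  where
  pre<x    = All.map (λ p≤v → s≤s (≤-trans p≤v v≤q)) pre≤v
  x-ranked = from (Ranked⇔suc-length pre r pre<x (Continues⇒sorted ≤-refl c)) refl

WIFubini⇔Continues : ∀ x r → WIFubini (x ∷ r) ⇔ (x ≡ 1 × Continues 1 1 r)
WIFubini⇔Continues x r = mk⇔ ⇒ ⇐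
  where
  ⇒ : WIFubini (x ∷ r) → x ≡ 1 × Continues 1 1 r
  ⇒ (x-ranked ∷ r-ranked , sorted) with refl ← to (Ranked⇔suc-length [] r [] sorted) x-ranked =
    refl , ranked⇒Continues [ 1 ] r (≤-refl ∷ []) sorted r-ranked
  ⇐ : x ≡ 1 × Continues 1 1 r → WIFubini (x ∷ r)
  ⇐ (refl , c) = one-ranked ∷ Continues⇒ranked [ 1 ] r (≤-refl ∷ []) ≤-refl one-ranked c , sorted
    where
    sorted = Continues⇒sorted ≤-refl c
    one-ranked = from (Ranked⇔suc-length [] r [] sorted) refl

continuations : (v q m : ℕ) → List (Vec ℕ m)
continuations v q zero    = []ᵛ ∷ []
continuations v q (suc m) =
  map (v ∷ᵛ_) (continuations v (suc q) m) ++ map (suc q ∷ᵛ_) (continuations (suc q) (suc q) m)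

∈-continuations⁺ : ∀ {v q m} (a : Vec ℕ m) → Continues v q (toList a) → a ∈ continuations v q m
∈-continuations⁺ []ᵛ      []      = Any.here refl
∈-continuations⁺ (_ ∷ᵛ a) (tie c) = ∈-++⁺ˡ (∈-map⁺ _ (∈-continuations⁺ a c))
∈-continuations⁺ (_ ∷ᵛ a) (new c) = ∈-++⁺ʳ _ (∈-map⁺ _ (∈-continuations⁺ a c))

∈-continuations⁻ : ∀ {v q} m (a : Vec ℕ m) → a ∈ continuations v q m → Continues v q (toList a)
∈-continuations⁻ zero []ᵛ _ = []
∈-continuations⁻ {v} {q} (suc m) _ a∈ with ∈-++⁻ (map (v ∷ᵛ_) (continuations v (suc q) m)) a∈
... | inj₁ a∈ties with b , b∈ , refl ← ∈-map⁻ _ a∈ties = tie (∈-continuations⁻ m b b∈)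
... | inj₂ a∈news with b , b∈ , refl ← ∈-map⁻ _ a∈news = new (∈-continuations⁻ m b b∈)

continuations-unique : ∀ {v q} m → v ≤ q → Unique (continuations v q m)
continuations-unique zero    _   = [] ∷ []
continuations-unique (suc m) v≤q = Unique.++⁺
  (Unique.map⁺ ∷-injectiveʳ (continuations-unique m (m≤n⇒m≤1+n v≤q)))
  (Unique.map⁺ ∷-injectiveʳ (continuations-unique m ≤-refl))
  λ (a∈ties , a∈news) → case ∈-map⁻ _ a∈ties , ∈-map⁻ _ a∈news of λ where
    ((_ , _ , refl) , (_ , _ , eq)) → <⇒≢ (s≤s v≤q) (∷-injectiveˡ eq)

length-continuations : ∀ v q m → length (continuations v q m) ≡ 2 ^ m
length-continuations v q zero    = refl
length-continuations v q (suc m) = begin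
  length (map (v ∷ᵛ_) ties ++ map (suc q ∷ᵛ_) news)
    ≡⟨ length-++ (map (v ∷ᵛ_) ties) ⟩
  length (map (v ∷ᵛ_) ties) + length (map (suc q ∷ᵛ_) news)
    ≡⟨ cong₂ _+_ (length-map _ ties) (length-map _ news) ⟩
  length ties + length news
    ≡⟨ cong₂ _+_ (length-continuations v (suc q) m) (length-continuations (suc q) (suc q) m) ⟩
  2 ^ m + 2 ^ m
    ≡⟨ cong (2 ^ m +_) (sym (+-identityʳ _)) ⟩
  2 ^ suc m ∎
  where
  open ≡-Reasoning
  ties = continuations v (suc q) m
  news = continuations (suc q) (suc q) m

rankings : (n : ℕ) → List (Vec ℕ (suc n))
rankings n = map (1 ∷ᵛ_) (continuations 1 1 n)

∈-rankings : ∀ {n x} {b : Vec ℕ n} → (x ∷ᵛ b) ∈ rankings n ⇔ (x ≡ 1 × Continues 1 1 (toList b))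
∈-rankings {n} {b = b} = mk⇔
  (λ xb∈ → case ∈-map⁻ _ xb∈ of λ where (_ , b∈ , refl) → refl , ∈-continuations⁻ n b b∈)
  (λ where (refl , c) → ∈-map⁺ _ (∈-continuations⁺ b c))

FRup↭rankings : ∀ n → FRup (suc n) ↭ rankings n
FRup↭rankings n = ∼bag⇒↭ (unique∧set⇒bag (FRup-unique (suc n)) rankings-unique same)
  where
  rankings-unique = Unique.map⁺ ∷-injectiveʳ (continuations-unique n ≤-refl)
  same : ∀ {a} → a ∈ FRup (suc n) ⇔ a ∈ rankings n
  same {x ∷ᵛ b} = ⇔.trans ∈-FRup (⇔.trans (WIFubini⇔Continues x (toList b)) (⇔.sym ∈-rankings))

filled : ℕ → List ℕ
filled zero    = []
filled (suc q) = suc q ∷ filled q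

occupied-filled : ∀ {t} q → t < q → occupied (suc t) (filled q) ≡ true
occupied-filled {t} (suc q) t<1+q with m≤n⇒m<n∨m≡n (≤-pred t<1+q)
... | inj₁ t<q  = trans (cong ((q ≡ᵇ t) ∨_) (occupied-filled q t<q)) (∨-zeroʳ (q ≡ᵇ t))
... | inj₂ refl = cong (_∨ occupied (suc q) (filled q)) (dec-true (q ≟ q) refl)

free-filled : ∀ {s} q → q < s → occupied s (filled q) ≡ false
free-filled zero    _     = refl
free-filled (suc q) 1+q<s =
  cong₂ _∨_ (dec-false (suc q ≟ _) (<⇒≢ 1+q<s)) (free-filled q (<-trans (n<1+n q) 1+q<s))

firstFree-filled : ∀ {t q} f → t ≤ q → q < t + f → firstFree f (suc t) (filled q) ≡ just (suc q)
firstFree-filled {t} zero t≤q q<t+0 = contradiction (≤-trans q<t+0 (≤-reflexive (+-identityʳ t))) (≤⇒≯ t≤q)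
firstFree-filled {t} {q} (suc f) t≤q q<t+1+f with m≤n⇒m<n∨m≡n t≤q
... | inj₁ t<q  rewrite occupied-filled q t<q = firstFree-filled f t<q (subst (q <_) (+-suc t f) q<t+1+f)
... | inj₂ refl rewrite free-filled q (n<1+n q) = refl

parkSpot-filled : ∀ {N t q} → t ≤ q → q < N → parkSpot N (suc t) (filled q) ≡ just (suc q)
parkSpot-filled {N} {t} t≤q q<N =
  firstFree-filled (N ∸ t) t≤q (subst (_ <_) (sym (m+[n∸m]≡n (≤-trans t≤q (<⇒≤ q<N)))) q<N)

luckyRun-parks : ∀ {N a s} occ as → parkSpot N a occ ≡ just s →
  luckyRun N occ (a ∷ as) ≡ (if s ≡ᵇ a then 1 else 0) + luckyRun N (s ∷ occ) as
luckyRun-parks occ as parks rewrite parks = refl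

luckyRun-tie : ∀ {N t q} as → t < q → q < N →
  luckyRun N (filled q) (suc t ∷ as) ≡ luckyRun N (filled (suc q)) as
luckyRun-tie {N} {t} {q} as t<q q<N = trans
  (luckyRun-parks {N} {suc t} (filled q) as (parkSpot-filled (<⇒≤ t<q) q<N))
  (cong (λ b → (if b then 1 else 0) + luckyRun N (filled (suc q)) as) (dec-false (q ≟ t) (>⇒≢ t<q)))

luckyRun-new : ∀ {N q} as → q < N →
  luckyRun N (filled q) (suc q ∷ as) ≡ suc (luckyRun N (filled (suc q)) as)
luckyRun-new {N} {q} as q<N = trans
  (luckyRun-parks {N} {suc q} (filled q) as (parkSpot-filled ≤-refl q<N))
  (cong (λ b → (if b then 1 else 0) + luckyRun N (filled (suc q)) as) (dec-true (q ≟ q) refl))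

luckyAfter : ∀ {m} (N q : ℕ) → Vec ℕ m → ℕ
luckyAfter N q a = luckyRun N (filled q) (toList a)

count-lucky-split : ∀ {N t q} m j → t < q → q < N →
  count (luckyAfter N q) j (continuations (suc t) q (suc m))
    ≡ count (luckyAfter N (suc q)) j (continuations (suc t) (suc q) m)
    + count (suc ∘ luckyAfter N (suc q)) j (continuations (suc q) (suc q) m)
count-lucky-split {N} {t} {q} m j t<q q<N = trans
  (count-++ (luckyAfter N q) j (map (suc t ∷ᵛ_) ties) (map (suc q ∷ᵛ_) news))
  (cong₂ _+_ (count-map {h = luckyAfter N (suc q)} (λ b → luckyRun-tie (toList b) t<q q<N) j ties)
             (count-map {h = suc ∘ luckyAfter N (suc q)} (λ b → luckyRun-new (toList b) q<N) j news))
  where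
  ties = continuations (suc t) (suc q) m
  news = continuations (suc q) (suc q) m

count-lucky : ∀ {N t q} m j → t < q → q + m ≤ N →
  count (luckyAfter N q) j (continuations (suc t) q m) ≡ m C j
count-lucky zero    zero    _ _ = refl
count-lucky zero    (suc j) _ _ = refl
count-lucky {N} {t} {q} (suc m) j t<q q+1+m≤N = trans (count-lucky-split m j t<q q<N) (pascal j)
  where
  1+q+m≤N = subst (_≤ N) (+-suc q m) q+1+m≤N
  q<N     = ≤-trans (m≤m+n (suc q) m) 1+q+m≤N
  lucky   = luckyAfter N (suc q)
  ties    = continuations (suc t) (suc q) m
  news    = continuations (suc q) (suc q) m

  pascal : ∀ j → count lucky j ties + count (suc ∘ lucky) j news ≡ suc m C j
  pascal zero    = cong₂ _+_ (count-lucky m 0 (m<n⇒m<1+n t<q) 1+q+m≤N) (count-suc-zero lucky news)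
  pascal (suc j) = begin
    count lucky (suc j) ties + count (suc ∘ lucky) (suc j) news
      ≡⟨ cong₂ _+_ (count-lucky m (suc j) (m<n⇒m<1+n t<q) 1+q+m≤N)
                   (trans (count-suc lucky j news) (count-lucky m j (n<1+n q) 1+q+m≤N)) ⟩
    m C suc j + m C j  ≡⟨ +-comm (m C suc j) (m C j) ⟩
    m C j + m C suc j  ≡⟨ nCk+nC[k+1]≡[n+1]C[k+1] m j ⟩
    suc m C suc j      ∎
    where open ≡-Reasoning

count-lucky-rankings : ∀ n j → count luckyCount (suc j) (rankings n) ≡ n C j
count-lucky-rankings n j = begin
  count luckyCount (suc j) (map (1 ∷ᵛ_) (continuations 1 1 n))
    ≡⟨ count-map {f = luckyCount} {1 ∷ᵛ_} (λ _ → refl) (suc j) (continuations 1 1 n) ⟩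
  count (suc ∘ luckyAfter (suc n) 1) (suc j) (continuations 1 1 n)
    ≡⟨ count-suc (luckyAfter (suc n) 1) j (continuations 1 1 n) ⟩
  count (luckyAfter (suc n) 1) j (continuations 1 1 n)
    ≡⟨ count-lucky n j (s≤s z≤n) ≤-refl ⟩
  n C j ∎
  where open ≡-Reasoning

theorem2p13 : (n : ℕ) → 1 ≤ n →
    ((k : ℕ) → 1 ≤ k → fFRup n k ≡ (n ∸ 1) C (k ∸ 1))
    × (length (FRup n) ≡ 2 ^ (n ∸ 1))
theorem2p13 (suc n) _ = lucky-cars , cardinality
  where
  lucky-cars : (k : ℕ) → 1 ≤ k → fFRup (suc n) k ≡ n C (k ∸ 1)
  lucky-cars (suc j) _ = trans (count-↭ luckyCount (suc j) (FRup↭rankings n)) (count-lucky-rankings n j)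

  cardinality : length (FRup (suc n)) ≡ 2 ^ n
  cardinality = begin
    length (FRup (suc n))         ≡⟨ ↭-length (FRup↭rankings n) ⟩
    length (rankings n)           ≡⟨ length-map _ (continuations 1 1 n) ⟩
    length (continuations 1 1 n)  ≡⟨ length-continuations 1 1 n ⟩
    2 ^ n                         ∎
    where open ≡-Reasoning
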